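{- Let $k\geq1$, let $\Phi$ be a graph invariant on $k$-vertex graphs, and let $S\subseteq E(K_k)$. Then $S$ is $\widehat{\Phi}$-maximal if and only if $S$ is $\widehat{f}_\Phi$-maximal.
   Context: All graphs are finite, simple and undirected. $K_k$ is the complete graph with vertex set $\{1,\dots,k\}$; for $S\subseteq E(K_k)$, $K_k[S]=(\{1,\dots,k\},S)$. $\Phi$ is an isomorphism-invariant map from graphs to $\mathbb{Q}$ with $\Phi(G)=0$ when $|V(G)|\ne k$. The alternating enumerator is $\widehat{\Phi}(H)=(-1)^{|E(H)|}\sum_{T\subseteq E(H)}(-1)^{|T|}\Phi(H[T])$. Define $f_\Phi:\{ -1,1\}^{E(K_k)}\to\mathbb{R}$ by $f_\Phi(\boldsymbol{x})=\Phi(K_k[S_{\boldsymbol{x}}])$ with $S_{\boldsymbol{x}}=\{e:x_e=-1\}$. Its Fourier coefficients $\widehat{f}_\Phi(T)$, $T\subseteq E(K_k)$, are the unique reals with $f_\Phi(\boldsymbol{x})=\sum_{T}\widehat{f}_\Phi(T)\prod_{e\in T}x_e$ for all $\boldsymbol{x}$. $S$ is $\widehat{f}_\Phi$-maximal if $\widehat{f}_\Phi(S)\neq0$ and $\widehat{f}_\Phi(S')=0$ for every $S\subsetneq S'\subseteq E(K_k)$; $S$ is $\widehat{\Phi}$-maximal if $\widehat{\Phi}(K_k[S])\neq0$ and $\widehat{\Phi}(K_k[S'])=0$ for every $S\subsetneq S'\subseteq E(K_k)$. -}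

module Defs where

open import Data.Nat using (ℕ; zero; suc)
open import Data.Bool using (Bool; true; false; if_then_else_; _∧_; _∨_)
open import Data.Fin using (Fin; _<?_; _≟_)
open import Data.Fin.Subset using (Subset; _⊆_; _⊂_; ∣_∣; inside; outside)
open import Data.Fin.Subset.Properties using (_⊆?_)
open import Data.Fin.Permutation using (Permutation′; _⟨$⟩ʳ_)
open import Data.List using (List; []; _∷_; _++_; map; concatMap; filter; allFin; length; lookup; foldr)
open import Data.Vec using (Vec; []; _∷_; tabulate)
open import Data.Product using (_×_; _,_; proj₁; proj₂)
open import Data.Rational using (ℚ; 0ℚ; 1ℚ; _+_; _*_; -_)
open import Relation.Nullary using (¬_; does)
open import Relation.Binary.PropositionalEquality using (_≡_; _≢_)

-- The complete graph K_k on vertex set Fin k (≅ {1,…,k}).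
-- E(K_k) is enumerated as the list of pairs (i , j) with i < j.

edgeList : (k : ℕ) → List (Fin k × Fin k)
edgeList k = concatMap (λ i → map (λ j → (i , j)) (filter (λ j → i <? j) (allFin k))) (allFin k)

E : ℕ → ℕ
E k = length (edgeList k)

ends : (k : ℕ) → Fin (E k) → Fin k × Fin k
ends k = lookup (edgeList k)

-- A subset S ⊆ E(K_k); it determines the graph K_k[S] = (Fin k , S).
EdgeSet : ℕ → Set
EdgeSet k = Subset (E k)

memb : ∀ {n} → Subset n → Fin n → Bool
memb [] ()
memb (inside ∷ p) Fin.zero = true
memb (outside ∷ p) Fin.zero = false
memb (_ ∷ p) (Fin.suc x) = memb p x

adj : (k : ℕ) → EdgeSet k → Fin k → Fin k → Bool
adj k S i j = foldr _∨_ false (map test (allFin (E k)))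
  where
  test : Fin (E k) → Bool
  test e = memb S e ∧ ((does (proj₁ (ends k e) ≟ i) ∧ does (proj₂ (ends k e) ≟ j))
                      ∨ (does (proj₁ (ends k e) ≟ j) ∧ does (proj₂ (ends k e) ≟ i)))

-- Φ restricted to graphs with vertex set {1,…,k} (the only values that
-- enter the statement; Φ vanishes on graphs with ≠ k vertices), is a map
-- EdgeSet k → ℚ.
IsoInvariant : (k : ℕ) → (EdgeSet k → ℚ) → Set
IsoInvariant k Φ = (σ : Permutation′ k) (S S′ : EdgeSet k) →
  (∀ i j → adj k S′ (σ ⟨$⟩ʳ i) (σ ⟨$⟩ʳ j) ≡ adj k S i j) → Φ S ≡ Φ S′

subsets : (n : ℕ) → List (Subset n)
subsets zero = [] ∷ []
subsets (suc n) = map (outside ∷_) (subsets n) ++ map (inside ∷_) (subsets n)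

sumℚ : List ℚ → ℚ
sumℚ = foldr _+_ 0ℚ

sgn : ℕ → ℚ
sgn zero = 1ℚ
sgn (suc n) = - sgn n

subsetsOf : ∀ {n} → Subset n → List (Subset n)
subsetsOf S = filter (λ T → T ⊆? S) (subsets _)

Φhat : (k : ℕ) → (EdgeSet k → ℚ) → EdgeSet k → ℚ
Φhat k Φ S = sgn ∣ S ∣ * sumℚ (map (λ T → sgn ∣ T ∣ * Φ T) (subsetsOf S))

data Sign : Set where
  plus minus : Sign

val : Sign → ℚ
val plus = 1ℚ
val minus = - 1ℚ

Cube : ℕ → Set
Cube n = Fin n → Sign

Sx : ∀ {n} → Cube n → Subset n
Sx x = tabulate (λ e → isMinus (x e))
  where
  isMinus : Sign → _
  isMinus plus = outside
  isMinus minus = inside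

fΦ : (k : ℕ) → (EdgeSet k → ℚ) → Cube (E k) → ℚ
fΦ k Φ x = Φ (Sx x)

χ : ∀ {n} → Subset n → Cube n → ℚ
χ {n} T x = foldr _*_ 1ℚ (map (λ e → if memb T e then val (x e) else 1ℚ) (allFin n))

IsFourierCoeffs : ∀ {n} → (Subset n → ℚ) → (Cube n → ℚ) → Set
IsFourierCoeffs {n} F f = ∀ x → f x ≡ sumℚ (map (λ T → F T * χ T x) (subsets n))

FourierMaximal : ∀ {n} → (Subset n → ℚ) → Subset n → Set
FourierMaximal F S = F S ≢ 0ℚ × (∀ S′ → S ⊂ S′ → F S′ ≡ 0ℚ)

ΦhatMaximal : (k : ℕ) → (EdgeSet k → ℚ) → EdgeSet k → Set
ΦhatMaximal k Φ S = Φhat k Φ S ≢ 0ℚ × (∀ S′ → S ⊂ S′ → Φhat k Φ S′ ≡ 0ℚ)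

-- Evaluating the Fourier expansion of f at the corner of the cube corresponding to V and
-- summing with signs over V ⊆ S is Fourier inversion on the subcube below S: the characters
-- χ_T with S ⊄ T cancel and the others contribute 2^|S|, so
--   Φ̂(K_k[S]) = (-2)^|S| Σ_{T ⊇ S} f̂(T).
-- Hence Φ̂ and the upper sums of f̂ vanish at the same sets, and a function and its upper sums
-- have the same maximal nonzero sets: if the upper sums vanish strictly above S, downward
-- induction shows that f̂ vanishes there too, and then f̂(S) is the upper sum at S.
module Submission where

open import Defs
open import Data.Bool using (Bool; true; false; if_then_else_)
open import Data.Fin using (Fin) renaming (zero to fzero; suc to fsuc)
open import Data.Fin.Subset using (Subset; Side; inside; outside; _⊂_; _⊃_; ∣_∣)
open import Data.Fin.Subset.Induction using (⊃-wellFounded)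
open import Data.Fin.Subset.Properties using (_⊆?_; ⊂-trans; out⊂; out⊂in; s⊂s)
open import Data.List using ([]; _∷_; _++_; map; filter; foldr; tabulate)
open import Data.List.Properties using (map-++; map-∘; map-tabulate; tabulate-cong)
open import Data.Nat using (ℕ; zero; suc; _≤_)
open import Data.Product using (_,_)
open import Data.Rational using (ℚ; 0ℚ; 1ℚ; ½; _+_; _*_; -_)
open import Data.Rational.Properties
  using (+-identityˡ; +-identityʳ; +-assoc; *-identityˡ; *-zeroʳ; *-assoc; *-comm; *-distribˡ-+)
open import Data.Rational.Solver using (module +-*-Solver)
open import Data.Vec using ([]; _∷_)
open import Function using (_∘_; id)
open import Function.Bundles using (_⇔_; mk⇔; Equivalence)
open import Function.Construct.Composition using (_⇔-∘_)
open import Induction.WellFounded using (Acc; acc)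
open import Relation.Binary.PropositionalEquality
open import Relation.Nullary using (does; yes; no)
open import Relation.Unary using (Decidable)

open +-*-Solver using (solve; _:=_; _:+_; _:*_; :-_; con)
open ≡-Reasoning

private
  variable
    n : ℕ

∑ : (Subset n → ℚ) → ℚ
∑ {zero}  g = g []
∑ {suc n} g = ∑ (λ T → g (outside ∷ T)) + ∑ (λ T → g (inside ∷ T))

syntax ∑ (λ T → e) = ∑[ T ] e

∑-cong : {g h : Subset n → ℚ} → (∀ T → g T ≡ h T) → ∑ g ≡ ∑ h
∑-cong {zero}  g≡h = g≡h []
∑-cong {suc n} g≡h = cong₂ _+_ (∑-cong (g≡h ∘ (outside ∷_))) (∑-cong (g≡h ∘ (inside ∷_)))

∑-zero : ∀ n → ∑ {n} (λ _ → 0ℚ) ≡ 0ℚ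
∑-zero zero    = refl
∑-zero (suc n) = cong₂ _+_ (∑-zero n) (∑-zero n)

∑-+ : (g h : Subset n → ℚ) → ∑[ T ] (g T + h T) ≡ ∑ g + ∑ h
∑-+ {zero}  g h = refl
∑-+ {suc n} g h = trans (cong₂ _+_ (∑-+ {n} _ _) (∑-+ {n} _ _)) (interchange gₒ hₒ gᵢ hᵢ)
  where
  gₒ = ∑ (g ∘ (outside ∷_))
  hₒ = ∑ (h ∘ (outside ∷_))
  gᵢ = ∑ (g ∘ (inside ∷_))
  hᵢ = ∑ (h ∘ (inside ∷_))
  interchange : ∀ a b c d → (a + b) + (c + d) ≡ (a + c) + (b + d)
  interchange = solve 4 (λ a b c d → (a :+ b) :+ (c :+ d) := (a :+ c) :+ (b :+ d)) refl

∑-*ˡ : ∀ c (g : Subset n → ℚ) → ∑[ T ] (c * g T) ≡ c * ∑ g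
∑-*ˡ {zero}  c g = refl
∑-*ˡ {suc n} c g = trans (cong₂ _+_ (∑-*ˡ {n} c _) (∑-*ˡ {n} c _)) (sym (*-distribˡ-+ c _ _))

∑-comm : ∀ {m} (G : Subset n → Subset m → ℚ) → ∑[ V ] ∑[ T ] G V T ≡ ∑[ T ] ∑[ V ] G V T
∑-comm {zero}  G = refl
∑-comm {suc n} {m} G = trans (cong₂ _+_ (∑-comm {n} {m} _) (∑-comm {n} {m} _)) (sym (∑-+ {m} _ _))

sumℚ-++ : ∀ xs ys → sumℚ (xs ++ ys) ≡ sumℚ xs + sumℚ ys
sumℚ-++ []       ys = sym (+-identityˡ _)
sumℚ-++ (x ∷ xs) ys = trans (cong (x +_) (sumℚ-++ xs ys)) (sym (+-assoc x _ _))

sumℚ-subsets : ∀ n (g : Subset n → ℚ) → sumℚ (map g (subsets n)) ≡ ∑ g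
sumℚ-subsets zero    g = +-identityʳ (g [])
sumℚ-subsets (suc n) g = begin
  sumℚ (map g (map (outside ∷_) (subsets n) ++ map (inside ∷_) (subsets n)))
    ≡⟨ cong sumℚ (map-++ g (map (outside ∷_) (subsets n)) _) ⟩
  sumℚ (map g (map (outside ∷_) (subsets n)) ++ map g (map (inside ∷_) (subsets n)))
    ≡⟨ sumℚ-++ (map g (map (outside ∷_) (subsets n))) _ ⟩
  sumℚ (map g (map (outside ∷_) (subsets n))) + sumℚ (map g (map (inside ∷_) (subsets n)))
    ≡⟨ cong₂ _+_ (trans (cong sumℚ (sym (map-∘ (subsets n)))) (sumℚ-subsets n _))
                 (trans (cong sumℚ (sym (map-∘ (subsets n)))) (sumℚ-subsets n _)) ⟩
  ∑ g ∎

when : Bool → ℚ → ℚ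
when true  q = q
when false _ = 0ℚ

when-*ˡ : ∀ b c q → when b (c * q) ≡ c * when b q
when-*ˡ true  c q = refl
when-*ˡ false c q = sym (*-zeroʳ c)

when-∑ : ∀ b (g : Subset n → ℚ) → when b (∑ g) ≡ ∑[ T ] when b (g T)
when-∑     true  g = refl
when-∑ {n} false g = sym (∑-zero n)

sumℚ-filter : ∀ {a p} {A : Set a} {P : A → Set p} (P? : Decidable P) (g : A → ℚ) xs →
              sumℚ (map g (filter P? xs)) ≡ sumℚ (map (λ x → when (does (P? x)) (g x)) xs)
sumℚ-filter P? g []       = refl
sumℚ-filter P? g (x ∷ xs) with does (P? x)
... | true  = cong (g x +_) (sumℚ-filter P? g xs)
... | false = trans (sumℚ-filter P? g xs) (sym (+-identityˡ _))

_⊆ᵇ_ : Subset n → Subset n → Bool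
T ⊆ᵇ S = does (T ⊆? S)

lowerSum : Subset n → (Subset n → ℚ) → ℚ
lowerSum S g = ∑[ V ] when (V ⊆ᵇ S) (g V)

upperSum : (Subset n → ℚ) → Subset n → ℚ
upperSum F S = ∑[ T ] when (S ⊆ᵇ T) (F T)

sumℚ-subsetsOf : (S : Subset n) (g : Subset n → ℚ) → sumℚ (map g (subsetsOf S)) ≡ lowerSum S g
sumℚ-subsetsOf {n} S g = trans (sumℚ-filter (_⊆? S) g (subsets n)) (sumℚ-subsets n _)

lowerSum-outside∷ : (S : Subset n) (g : Subset (suc n) → ℚ) →
                    lowerSum (outside ∷ S) g ≡ lowerSum S (g ∘ (outside ∷_))
lowerSum-outside∷ {n} S g = trans (cong (lowerSum S (g ∘ (outside ∷_)) +_) (∑-zero n)) (+-identityʳ _)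

lowerSum-cong : (S : Subset n) {g h : Subset n → ℚ} → (∀ V → g V ≡ h V) → lowerSum S g ≡ lowerSum S h
lowerSum-cong S g≡h = ∑-cong (λ V → cong (when (V ⊆ᵇ S)) (g≡h V))

lowerSum-*ˡ : (S : Subset n) (c : ℚ) (g : Subset n → ℚ) → lowerSum S (λ V → c * g V) ≡ c * lowerSum S g
lowerSum-*ˡ S c g =
  trans (∑-cong (λ V → when-*ˡ (V ⊆ᵇ S) c (g V))) (∑-*ˡ c (λ V → when (V ⊆ᵇ S) (g V)))

point : Subset n → Cube n
point U e = if memb U e then minus else plus

Sx-point : (U : Subset n) → Sx (point U) ≡ U
Sx-point []            = refl
Sx-point (inside ∷ U)  = cong (inside ∷_) (Sx-point U)
Sx-point (outside ∷ U) = cong (outside ∷_) (Sx-point U)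

fourier-at-point : ∀ {φ : Subset n → ℚ} (F : Subset n → ℚ) → IsFourierCoeffs F (φ ∘ Sx) →
                   ∀ U → φ U ≡ ∑[ T ] (F T * χ T (point U))
fourier-at-point {n} {φ} F isFourier U = begin
  φ U                                              ≡⟨ cong φ (Sx-point U) ⟨
  φ (Sx (point U))                                 ≡⟨ isFourier (point U) ⟩
  sumℚ (map (λ T → F T * χ T (point U)) (subsets n)) ≡⟨ sumℚ-subsets n _ ⟩
  ∑[ T ] (F T * χ T (point U))                       ∎

χ₁ : Side → Side → ℚ
χ₁ _       outside = 1ℚ
χ₁ outside inside  = 1ℚ
χ₁ inside  inside  = - 1ℚ

χ-point-∷ : ∀ d c (T U : Subset n) → χ (d ∷ T) (point (c ∷ U)) ≡ χ₁ d c * χ T (point U)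
χ-point-∷ d c T U =
  cong₂ _*_ (head d c) (cong (foldr _*_ 1ℚ) (begin
    map (factor (d ∷ T) (c ∷ U)) (tabulate fsuc) ≡⟨ map-tabulate fsuc _ ⟩
    tabulate (factor (d ∷ T) (c ∷ U) ∘ fsuc)     ≡⟨ tabulate-cong (tail d c) ⟩
    tabulate (factor T U)                        ≡⟨ map-tabulate id _ ⟨
    map (factor T U) (tabulate id)               ∎))
  where
  factor : ∀ {m} → Subset m → Subset m → Fin m → ℚ
  factor T U e = if memb T e then val (point U e) else 1ℚ
  head : ∀ d c → factor (d ∷ T) (c ∷ U) fzero ≡ χ₁ d c
  head inside  inside  = refl
  head inside  outside = refl
  head outside inside  = refl
  head outside outside = refl
  tail : ∀ d c e → factor (d ∷ T) (c ∷ U) (fsuc e) ≡ factor T U e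
  tail inside  inside  e = refl
  tail inside  outside e = refl
  tail outside inside  e = refl
  tail outside outside e = refl

χ-point-outside∷ : ∀ d (T U : Subset n) → χ (d ∷ T) (point (outside ∷ U)) ≡ χ T (point U)
χ-point-outside∷ d T U = trans (χ-point-∷ d outside T U) (*-identityˡ _)

2^_ : ℕ → ℚ
2^ zero  = 1ℚ
2^ suc m = (1ℚ + 1ℚ) * 2^ m

lowerSum-sgn-χ-inside∷ : ∀ d (S T : Subset n) →
                         lowerSum S (λ V → sgn ∣ inside ∷ V ∣ * χ (d ∷ T) (point (inside ∷ V)))
                           ≡ (- χ₁ d inside) * lowerSum S (λ V → sgn ∣ V ∣ * χ T (point V))
lowerSum-sgn-χ-inside∷ d S T = begin
  lowerSum S (λ V → (- sgn ∣ V ∣) * χ (d ∷ T) (point (inside ∷ V)))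
    ≡⟨ lowerSum-cong S (λ V → trans (cong ((- sgn ∣ V ∣) *_) (χ-point-∷ d inside T V))
                                    (move-sign (sgn ∣ V ∣) (χ₁ d inside) (χ T (point V)))) ⟩
  lowerSum S (λ V → (- χ₁ d inside) * (sgn ∣ V ∣ * χ T (point V)))
    ≡⟨ lowerSum-*ˡ S (- χ₁ d inside) _ ⟩
  (- χ₁ d inside) * lowerSum S (λ V → sgn ∣ V ∣ * χ T (point V)) ∎
  where
  move-sign : ∀ s c x → (- s) * (c * x) ≡ (- c) * (s * x)
  move-sign = solve 3 (λ s c x → (:- s) :* (c :* x) := (:- c) :* (s :* x)) refl

lowerSum-sgn-χ : (S T : Subset n) →
                 lowerSum S (λ V → sgn ∣ V ∣ * χ T (point V)) ≡ when (S ⊆ᵇ T) (2^ ∣ S ∣)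
lowerSum-sgn-χ []            []      = refl
lowerSum-sgn-χ (outside ∷ S) (d ∷ T) = begin
  lowerSum (outside ∷ S) (λ V → sgn ∣ V ∣ * χ (d ∷ T) (point V))
    ≡⟨ lowerSum-outside∷ S (λ V → sgn ∣ V ∣ * χ (d ∷ T) (point V)) ⟩
  lowerSum S (λ V → sgn ∣ V ∣ * χ (d ∷ T) (point (outside ∷ V)))
    ≡⟨ lowerSum-cong S (λ V → cong (sgn ∣ V ∣ *_) (χ-point-outside∷ d T V)) ⟩
  lowerSum S (λ V → sgn ∣ V ∣ * χ T (point V))
    ≡⟨ lowerSum-sgn-χ S T ⟩
  when (S ⊆ᵇ T) (2^ ∣ S ∣) ∎
lowerSum-sgn-χ (inside ∷ S) (d ∷ T) = begin
  lowerSum (inside ∷ S) (λ V → sgn ∣ V ∣ * χ (d ∷ T) (point V))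
    ≡⟨ cong₂ _+_ (lowerSum-cong S (λ V → cong (sgn ∣ V ∣ *_) (χ-point-outside∷ d T V)))
                 (lowerSum-sgn-χ-inside∷ d S T) ⟩
  K + (- χ₁ d inside) * K
    ≡⟨ combine d ⟩
  when ((inside ∷ S) ⊆ᵇ (d ∷ T)) (2^ ∣ inside ∷ S ∣) ∎
  where
  K = lowerSum S (λ V → sgn ∣ V ∣ * χ T (point V))
  cancel : ∀ x → x + (- 1ℚ) * x ≡ 0ℚ
  cancel = solve 1 (λ x → x :+ (:- con 1ℚ) :* x := con 0ℚ) refl
  double : ∀ x → x + (- (- 1ℚ)) * x ≡ (1ℚ + 1ℚ) * x
  double = solve 1 (λ x → x :+ (:- (:- con 1ℚ)) :* x := (con 1ℚ :+ con 1ℚ) :* x) refl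
  combine : ∀ d → K + (- χ₁ d inside) * K ≡ when ((inside ∷ S) ⊆ᵇ (d ∷ T)) (2^ ∣ inside ∷ S ∣)
  combine outside = cancel K
  combine inside  = begin
    K + (- (- 1ℚ)) * K                           ≡⟨ double K ⟩
    (1ℚ + 1ℚ) * K                                ≡⟨ cong ((1ℚ + 1ℚ) *_) (lowerSum-sgn-χ S T) ⟩
    (1ℚ + 1ℚ) * when (S ⊆ᵇ T) (2^ ∣ S ∣)  ≡⟨ when-*ˡ (S ⊆ᵇ T) (1ℚ + 1ℚ) (2^ ∣ S ∣) ⟨
    when (S ⊆ᵇ T) (2^ ∣ inside ∷ S ∣)     ∎

lowerSum-sgn-fourier : (F : Subset n → ℚ) (S : Subset n) →
                       lowerSum S (λ V → sgn ∣ V ∣ * ∑[ T ] (F T * χ T (point V)))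
                         ≡ 2^ ∣ S ∣ * upperSum F S
lowerSum-sgn-fourier {n} F S = begin
  ∑[ V ] when (V ⊆ᵇ S) (sgn ∣ V ∣ * ∑[ T ] (F T * χ T (point V)))
    ≡⟨ ∑-cong (λ V → trans (cong (when (V ⊆ᵇ S)) (sym (∑-*ˡ {n} (sgn ∣ V ∣) _)))
                           (when-∑ {n} (V ⊆ᵇ S) _)) ⟩
  ∑[ V ] ∑[ T ] when (V ⊆ᵇ S) (sgn ∣ V ∣ * (F T * χ T (point V)))
    ≡⟨ ∑-comm {n} {n} _ ⟩
  ∑[ T ] ∑[ V ] when (V ⊆ᵇ S) (sgn ∣ V ∣ * (F T * χ T (point V)))
    ≡⟨ ∑-cong (λ T → trans (lowerSum-cong S (λ V → *-comm-middle (sgn ∣ V ∣) (F T) _))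
                           (lowerSum-*ˡ S (F T) _)) ⟩
  ∑[ T ] (F T * lowerSum S (λ V → sgn ∣ V ∣ * χ T (point V)))
    ≡⟨ ∑-cong (λ T → cong (F T *_) (lowerSum-sgn-χ S T)) ⟩
  ∑[ T ] (F T * when (S ⊆ᵇ T) (2^ ∣ S ∣))
    ≡⟨ ∑-cong (λ T → pull-out (S ⊆ᵇ T) (F T) (2^ ∣ S ∣)) ⟩
  ∑[ T ] (2^ ∣ S ∣ * when (S ⊆ᵇ T) (F T))
    ≡⟨ ∑-*ˡ {n} (2^ ∣ S ∣) _ ⟩
  2^ ∣ S ∣ * upperSum F S ∎
  where
  *-comm-middle : ∀ a b c → a * (b * c) ≡ b * (a * c)
  *-comm-middle = solve 3 (λ a b c → a :* (b :* c) := b :* (a :* c)) refl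
  pull-out : ∀ b x c → x * when b c ≡ c * when b x
  pull-out b x c = trans (sym (when-*ˡ b x c)) (trans (cong (when b) (*-comm x c)) (when-*ˡ b c x))

-- Φhat k is alternatingSum at n = E k by definition, so ΦhatMaximal k Φ is
-- FourierMaximal (alternatingSum Φ).
alternatingSum : (Subset n → ℚ) → Subset n → ℚ
alternatingSum φ S = sgn ∣ S ∣ * sumℚ (map (λ T → sgn ∣ T ∣ * φ T) (subsetsOf S))

alternatingSum-fourier : ∀ {φ : Subset n → ℚ} (F : Subset n → ℚ) → IsFourierCoeffs F (φ ∘ Sx) →
                         ∀ S → alternatingSum φ S ≡ (sgn ∣ S ∣ * 2^ ∣ S ∣) * upperSum F S
alternatingSum-fourier {φ = φ} F isFourier S = begin
  sgn ∣ S ∣ * sumℚ (map (λ T → sgn ∣ T ∣ * φ T) (subsetsOf S))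
    ≡⟨ cong (sgn ∣ S ∣ *_) (sumℚ-subsetsOf S _) ⟩
  sgn ∣ S ∣ * lowerSum S (λ V → sgn ∣ V ∣ * φ V)
    ≡⟨ cong (sgn ∣ S ∣ *_)
            (lowerSum-cong S (λ V → cong (sgn ∣ V ∣ *_) (fourier-at-point F isFourier V))) ⟩
  sgn ∣ S ∣ * lowerSum S (λ V → sgn ∣ V ∣ * ∑[ T ] (F T * χ T (point V)))
    ≡⟨ cong (sgn ∣ S ∣ *_) (lowerSum-sgn-fourier F S) ⟩
  sgn ∣ S ∣ * (2^ ∣ S ∣ * upperSum F S)
    ≡⟨ *-assoc (sgn ∣ S ∣) (2^ ∣ S ∣) (upperSum F S) ⟨
  (sgn ∣ S ∣ * 2^ ∣ S ∣) * upperSum F S ∎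

½^_ : ℕ → ℚ
½^ zero  = 1ℚ
½^ suc m = ½ * ½^ m

sgn*½^-inverse : ∀ m → (sgn m * ½^ m) * (sgn m * 2^ m) ≡ 1ℚ
sgn*½^-inverse zero    = refl
sgn*½^-inverse (suc m) = begin
  ((- sgn m) * (½ * ½^ m)) * ((- sgn m) * ((1ℚ + 1ℚ) * 2^ m))
    ≡⟨ regroup (sgn m) (½^ m) (2^ m) ½ (1ℚ + 1ℚ) ⟩
  ((sgn m * ½^ m) * (sgn m * 2^ m)) * (½ * (1ℚ + 1ℚ))
    ≡⟨ cong (_* (½ * (1ℚ + 1ℚ))) (sgn*½^-inverse m) ⟩
  1ℚ * (½ * (1ℚ + 1ℚ))
    ≡⟨⟩
  1ℚ ∎
  where
  regroup : ∀ s h p a b → ((- s) * (a * h)) * ((- s) * (b * p)) ≡ ((s * h) * (s * p)) * (a * b)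
  regroup = solve 5 (λ s h p a b → ((:- s) :* (a :* h)) :* ((:- s) :* (b :* p))
                                   := ((s :* h) :* (s :* p)) :* (a :* b)) refl

*-invertibleˡ-≡0 : ∀ a b {x} → b * a ≡ 1ℚ → a * x ≡ 0ℚ → x ≡ 0ℚ
*-invertibleˡ-≡0 a b {x} ba≡1 ax≡0 = begin
  x             ≡⟨ *-identityˡ x ⟨
  1ℚ * x        ≡⟨ cong (_* x) ba≡1 ⟨
  (b * a) * x   ≡⟨ *-assoc b a x ⟩
  b * (a * x)   ≡⟨ cong (b *_) ax≡0 ⟩
  b * 0ℚ        ≡⟨ *-zeroʳ b ⟩
  0ℚ            ∎

alternatingSum≡0⇔upperSum≡0 : ∀ {φ : Subset n → ℚ} (F : Subset n → ℚ) → IsFourierCoeffs F (φ ∘ Sx) →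
                              ∀ S → (alternatingSum φ S ≡ 0ℚ ⇔ upperSum F S ≡ 0ℚ)
alternatingSum≡0⇔upperSum≡0 {φ = φ} F isFourier S = mk⇔
  (λ alt≡0 → *-invertibleˡ-≡0 (sgn ∣ S ∣ * 2^ ∣ S ∣) (sgn ∣ S ∣ * ½^ ∣ S ∣) (sgn*½^-inverse ∣ S ∣)
                              (trans (sym (alternatingSum-fourier F isFourier S)) alt≡0))
  (λ up≡0 → begin
    alternatingSum φ S                    ≡⟨ alternatingSum-fourier F isFourier S ⟩
    (sgn ∣ S ∣ * 2^ ∣ S ∣) * upperSum F S ≡⟨ cong ((sgn ∣ S ∣ * 2^ ∣ S ∣) *_) up≡0 ⟩
    (sgn ∣ S ∣ * 2^ ∣ S ∣) * 0ℚ           ≡⟨ *-zeroʳ (sgn ∣ S ∣ * 2^ ∣ S ∣) ⟩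
    0ℚ                                    ∎)

VanishesAbove : (Subset n → ℚ) → Subset n → Set
VanishesAbove F S = ∀ T → S ⊂ T → F T ≡ 0ℚ

upperSum-top : (F : Subset n → ℚ) (S : Subset n) → VanishesAbove F S → upperSum F S ≡ F S
upperSum-top {zero}  F []            _     = refl
upperSum-top {suc n} F (outside ∷ S) F≡0 = begin
  upperSum (F ∘ (outside ∷_)) S + ∑[ T ] when (S ⊆ᵇ T) (F (inside ∷ T))
    ≡⟨ cong₂ _+_ (upperSum-top (F ∘ (outside ∷_)) S (λ T S⊂T → F≡0 (outside ∷ T) (out⊂ S⊂T)))
                 (trans (∑-cong insideTerm≡0) (∑-zero n)) ⟩
  F (outside ∷ S) + 0ℚ
    ≡⟨ +-identityʳ _ ⟩
  F (outside ∷ S) ∎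
  where
  insideTerm≡0 : ∀ T → when (S ⊆ᵇ T) (F (inside ∷ T)) ≡ 0ℚ
  insideTerm≡0 T with S ⊆? T
  ... | yes S⊆T = F≡0 (inside ∷ T) (out⊂in S⊆T)
  ... | no  _   = refl
upperSum-top {suc n} F (inside ∷ S) F≡0 = begin
  ∑ {n} (λ _ → 0ℚ) + upperSum (F ∘ (inside ∷_)) S
    ≡⟨ cong₂ _+_ (∑-zero n) (upperSum-top (F ∘ (inside ∷_)) S (λ T S⊂T → F≡0 (inside ∷ T) (s⊂s S⊂T))) ⟩
  0ℚ + F (inside ∷ S)
    ≡⟨ +-identityˡ _ ⟩
  F (inside ∷ S) ∎

vanishesAbove-upperSum : (F : Subset n → ℚ) (S : Subset n) →
                         VanishesAbove F S → VanishesAbove (upperSum F) S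
vanishesAbove-upperSum F S F≡0 T S⊂T =
  trans (upperSum-top F T (λ U T⊂U → F≡0 U (⊂-trans S⊂T T⊂U))) (F≡0 T S⊂T)

vanishesAbove-upperSum⁻ : (F : Subset n → ℚ) (S : Subset n) →
                          VanishesAbove (upperSum F) S → VanishesAbove F S
vanishesAbove-upperSum⁻ F S upperSum≡0 T = go T (⊃-wellFounded T)
  where
  go : ∀ T → Acc _⊃_ T → S ⊂ T → F T ≡ 0ℚ
  go T (acc rec) S⊂T = begin
    F T          ≡⟨ upperSum-top F T (λ U T⊂U → go U (rec T⊂U) (⊂-trans S⊂T T⊂U)) ⟨
    upperSum F T ≡⟨ upperSum≡0 T S⊂T ⟩
    0ℚ           ∎

FourierMaximal-upperSum : (F : Subset n → ℚ) (S : Subset n) →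
                          FourierMaximal (upperSum F) S ⇔ FourierMaximal F S
FourierMaximal-upperSum F S = mk⇔
  (λ (upperSumS≢0 , upperSum≡0) → let F≡0 = vanishesAbove-upperSum⁻ F S upperSum≡0 in
      (λ FS≡0 → upperSumS≢0 (trans (upperSum-top F S F≡0) FS≡0)) , F≡0)
  (λ (FS≢0 , F≡0) →
     (λ upperSumS≡0 → FS≢0 (trans (sym (upperSum-top F S F≡0)) upperSumS≡0)) ,
     vanishesAbove-upperSum F S F≡0)

FourierMaximal-cong-≡0 : {f g : Subset n → ℚ} → (∀ T → f T ≡ 0ℚ ⇔ g T ≡ 0ℚ) →
                          ∀ S → FourierMaximal f S ⇔ FourierMaximal g S
FourierMaximal-cong-≡0 f≡0⇔g≡0 S = mk⇔
  (λ (fS≢0 , f≡0) → fS≢0 ∘ from (f≡0⇔g≡0 S) , λ T S⊂T → to (f≡0⇔g≡0 T) (f≡0 T S⊂T))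
  (λ (gS≢0 , g≡0) → gS≢0 ∘ to (f≡0⇔g≡0 S) , λ T S⊂T → from (f≡0⇔g≡0 T) (g≡0 T S⊂T))
  where open Equivalence

lemma4p1 : (k : ℕ) → 1 ≤ k → (Φ : EdgeSet k → ℚ) → IsoInvariant k Φ →
           (F : EdgeSet k → ℚ) → IsFourierCoeffs F (fΦ k Φ) →
           (S : EdgeSet k) → (ΦhatMaximal k Φ S ⇔ FourierMaximal F S)
lemma4p1 k _ Φ _ F isFourier S =
  FourierMaximal-upperSum F S ⇔-∘ FourierMaximal-cong-≡0 (alternatingSum≡0⇔upperSum≡0 F isFourier) S
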